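{- Let $(G,\beta)$ be an edge-labeled graph (in the setting described in the context) with vertices $v_1,\dots,v_n$. Set $G_n=G$ and, for $i=n,n-1,\dots,1$, let $G_{i-1}$ be the reduced graph of $G_i$ associated to the vertex $v_i$, so that $G_i$ has vertices $v_1,\dots,v_i$ and $\hat R_{G_0}=0$. Let $\psi_i:\hat R_{G_i}\to\hat R_{G_{i-1}}$, $(f_{v_1},\dots,f_{v_i})\mapsto(f_{v_1},\dots,f_{v_{i-1}})$. Then $\hat R_G\cong\ker\psi_1\oplus\ker\psi_2\oplus\cdots\oplus\ker\psi_n$, where each $\ker\psi_i$ is a submodule (of $\hat R_{G_i}$) of rank $1$.
   Context: Setting: $G$ is a finite connected simple graph. Each vertex $v$ is labeled by $M_v=m_v\mathbb{Z}$ ($m_v\in\mathbb{Z}$), each edge $e$ by $\mathbb{Z}/r_e\mathbb{Z}$ ($r_e\in\mathbb{Z}$). A spline is $f\in\prod_v M_v$ with $f_u-f_v\in r_e\mathbb{Z}$ for every edge $e=uv$; $\hat R_G$ is the $\mathbb{Z}$-module of splines. $(a,b,\dots)$ denotes gcd and $[a,b,\dots]$ lcm. Reduced graph associated to a vertex $v$: (1) delete $v$ and its incident edges; each neighbor $w$ of $v$ is kept with vertex module replaced by $[m_w,(m_v,r_{vw})]\mathbb{Z}$; for each pair of distinct neighbors $w,w'$ of $v$ add an edge $ww'$ labeled $(r_{vw},r_{vw'})$; (2) replace any set of parallel edges with labels $r_1,\dots,r_k$ by a single edge labeled $[r_1,\dots,r_k]$. The rank of a $\mathbb{Z}$-module is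 the size of a minimum generating set. -}

module Defs where

open import Data.Nat using (ℕ; zero; suc; _≤_)
open import Data.Fin using (Fin; fromℕ; inject₁; _≟_)
open import Data.Bool using (Bool; true; false; _∧_; _∨_; not; if_then_else_)
open import Data.Integer using (ℤ; 0ℤ; _+_; _-_; _*_)
open import Data.Integer.Divisibility using (_∣_)
open import Data.Integer.GCD using (gcd)
open import Data.Integer.LCM using (lcm)
open import Data.Vec using (Vec; []; _∷_)
open import Data.Product using (Σ; _×_; ∃; ∃-syntax; _,_)
open import Data.Unit using (⊤)
open import Relation.Nullary using (¬_; does)
open import Relation.Binary.PropositionalEquality using (_≡_)

-- Vectors of integers indexed by the vertices v₁,…,vₙ  (vertex vᵢ = index i-1).
V : ℕ → Set
V n = Fin n → ℤ

-- An edge-labeled graph on the vertex set Fin n: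
--   adj u v : whether uv is an edge,
--   m v     : the generator of the vertex module M_v = m_v ℤ,
--   r u v   : the label r_e of the edge e = uv (only meaningful when adj u v ≡ true).
record EGraph (n : ℕ) : Set where
  field
    adj : Fin n → Fin n → Bool
    m   : Fin n → ℤ
    r   : Fin n → Fin n → ℤ
open EGraph public

data Path {n : ℕ} (G : EGraph n) : Fin n → Fin n → Set where
  here : ∀ {u} → Path G u u
  step : ∀ {u v w} → adj G u v ≡ true → Path G v w → Path G u w

record WellFormed {n : ℕ} (G : EGraph n) : Set where
  field
    adj-sym   : ∀ u v → adj G u v ≡ adj G v u
    adj-irref : ∀ u → adj G u u ≡ false
    r-sym     : ∀ u v → r G u v ≡ r G v u
    connected : ∀ u v → Path G u v

Spline : ∀ {n} → EGraph n → V n → Set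
Spline G f = (∀ v → m G v ∣ f v) × (∀ u v → adj G u v ≡ true → r G u v ∣ (f u - f v))

-- The reduced graph of G (on vertices Fin (suc n)) associated to its last vertex vₙ₊₁ = fromℕ n.
-- Neighbours w of v get module [m_w,(m_v,r_vw)]; each pair of distinct neighbours w,w' gets
-- an edge labelled (r_vw,r_vw'), merged by lcm with an already existing edge ww'.
reduce : ∀ {n} → EGraph (suc n) → EGraph n
reduce {n} G = record { adj = adj' ; m = m' ; r = r' }
  where
    v : Fin (suc n)
    v = fromℕ n
    nb : Fin n → Bool
    nb w = adj G v (inject₁ w)
    newEdge : Fin n → Fin n → Bool
    newEdge w w' = nb w ∧ nb w' ∧ not (does (w ≟ w'))
    adj' : Fin n → Fin n → Bool
    adj' w w' = adj G (inject₁ w) (inject₁ w') ∨ newEdge w w'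
    m' : Fin n → ℤ
    m' w = if nb w then lcm (m G (inject₁ w)) (gcd (m G v) (r G v (inject₁ w))) else m G (inject₁ w)
    r' : Fin n → Fin n → ℤ
    r' w w' = if adj G (inject₁ w) (inject₁ w')
              then (if newEdge w w'
                    then lcm (r G (inject₁ w) (inject₁ w')) (gcd (r G v (inject₁ w)) (r G v (inject₁ w')))
                    else r G (inject₁ w) (inject₁ w'))
              else gcd (r G v (inject₁ w)) (r G v (inject₁ w'))

ψ : ∀ {n} → V (suc n) → V n
ψ f w = f (inject₁ w)

Ker : ∀ {n} → EGraph (suc n) → V (suc n) → Set
Ker G f = Spline G f × (∀ w → ψ f w ≡ 0ℤ)

AllStages : (∀ {k} → EGraph (suc k) → Set) → ∀ {n} → EGraph n → Set
AllStages P {zero}  G = ⊤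
AllStages P {suc n} G = P G × AllStages P (reduce G)

-- Elements of the external direct sum ker ψₙ ⊕ … ⊕ ker ψ₁, as tuples of vectors.
Tup : ℕ → Set
Tup zero    = ⊤
Tup (suc n) = V (suc n) × Tup n

InSum : ∀ {n} → EGraph n → Tup n → Set
InSum {zero}  G t       = ⊤
InSum {suc n} G (f , t) = Ker G f × InSum (reduce G) t

_≈V_ : ∀ {n} → V n → V n → Set
f ≈V g = ∀ x → f x ≡ g x

_≈T_ : ∀ {n} → Tup n → Tup n → Set
_≈T_ {zero}  s t             = ⊤
_≈T_ {suc n} (f , s) (g , t) = f ≈V g × s ≈T t

_+V_ : ∀ {n} → V n → V n → V n
(f +V g) x = f x + g x

_·V_ : ∀ {n} → ℤ → V n → V n
(c ·V f) x = c * f x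

_+T_ : ∀ {n} → Tup n → Tup n → Tup n
_+T_ {zero}  s t             = s
_+T_ {suc n} (f , s) (g , t) = (f +V g) , (s +T t)

_·T_ : ∀ {n} → ℤ → Tup n → Tup n
_·T_ {zero}  c t       = t
_·T_ {suc n} c (f , t) = (c ·V f) , (c ·T t)

record SplineSumIso {n : ℕ} (G : EGraph n) : Set where
  field
    Φ        : (f : V n) → Spline G f → Tup n
    Φ-into   : ∀ f (p : Spline G f) → InSum G (Φ f p)
    Φ-cong   : ∀ f g (p : Spline G f) (q : Spline G g) → f ≈V g → Φ f p ≈T Φ g q
    Φ-add    : ∀ f g (p : Spline G f) (q : Spline G g) (pq : Spline G (f +V g)) →
               Φ (f +V g) pq ≈T (Φ f p +T Φ g q)
    Φ-scale  : ∀ c f (p : Spline G f) (cp : Spline G (c ·V f)) →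
               Φ (c ·V f) cp ≈T (c ·T Φ f p)
    Φ-inj    : ∀ f g (p : Spline G f) (q : Spline G g) → Φ f p ≈T Φ g q → f ≈V g
    Φ-surj   : ∀ t → InSum G t → Σ (V n) λ f → Σ (Spline G f) λ p → Φ f p ≈T t

-- Rank of a submodule P ⊆ ℤⁿ: minimum size of a generating set.
lincomb : ∀ {n k} → Vec ℤ k → Vec (V n) k → V n
lincomb []       []       x = 0ℤ
lincomb (c ∷ cs) (g ∷ gs) x = c * g x + lincomb cs gs x

data AllV {A : Set} (P : A → Set) : ∀ {k} → Vec A k → Set where
  []  : AllV P []
  _∷_ : ∀ {k x} {xs : Vec A k} → P x → AllV P xs → AllV P (x ∷ xs)

GeneratedBy : ∀ {n k} → (V n → Set) → Vec (V n) k → Set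
GeneratedBy P gs = AllV P gs × (∀ f → P f → Σ (Vec ℤ _) λ cs → f ≈V lincomb cs gs)

HasRank : ∀ {n} → (V n → Set) → ℕ → Set
HasRank {n} P k =
  Σ (Vec (V n) k) (GeneratedBy P) ×
  (∀ j (gs : Vec (V n) j) → GeneratedBy P gs → k ≤ j)

KerRank1 : ∀ {k} → EGraph (suc k) → Set
KerRank1 G = HasRank (Ker G) 1

PsiWellDefined : ∀ {k} → EGraph (suc k) → Set
PsiWellDefined G = ∀ f → Spline G f → Spline (reduce G) (ψ f)

-- Forgetting the last vertex v maps splines of G to splines of the reduced graph G′ (the new
-- labels of G′ are exactly the constraints a spline of G imposes through v), and onto them by the
-- generalised Chinese remainder theorem, whose pairwise compatibility conditions are again those
-- labels. The kernel consists of the splines vanishing off v; their values at v are the multiples of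
-- d = lcm (m_v , r_vw for w adjacent to v) ≠ 0, so ker ψ = ℤ (0,…,0,d) has rank 1. By induction R̂_{G′}
-- is free; lifting a basis gives a linear section σ of ψ, and f ↦ (f − σ (ψ f) , ψ f) splits
-- R̂_G ≅ ker ψ ⊕ R̂_{G′}.
module Submission where

open import Defs
open import Algebra.Bundles using (AbelianGroup)
open import Data.Bool.Base using (Bool; true; false; _∧_; _∨_; not; if_then_else_)
open import Data.Bool.Properties using (∧-conicalˡ; ∧-conicalʳ)
open import Data.Empty using (⊥-elim)
open import Data.Fin.Base using (Fin; zero; suc; fromℕ; inject₁)
open import Data.Fin.Properties using (_≟_)
open import Data.Fin.Relation.Unary.Top using (view; ‵fromℕ; ‵inject₁; view-fromℕ; view-inject₁)
open import Data.Integer.Base using (ℤ; 0ℤ; 1ℤ; -1ℤ; +_; ∣_∣; _+_; _-_; _*_; -_; ≢-nonZero)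
open import Data.Integer.Divisibility.Signed
  using (_∣_; divides; ∣ᵤ⇒∣; ∣⇒∣ᵤ; ∣-refl; ∣-trans; ∣m∣∣m; m∣∣m∣; ∣m∣n⇒∣m+n; ∣m∣n⇒∣m-n; ∣m⇒∣-m;
         ∣n⇒∣m*n; ∣m⇒∣m*n; *-monoˡ-∣; *-monoʳ-∣; *-cancelʳ-∣; 0∣⇒≡0)
open import Data.Integer.GCD
  using (gcd; gcd[i,j]∣i; gcd[i,j]∣j; gcd-greatest; gcd[i,j]≡0⇒i≡0; gcd-zeroˡ; gcd-zeroʳ; gcd-comm)
open import Data.Integer.LCM using (lcm; i∣lcm[i,j]; j∣lcm[i,j]; lcm-least)
import Data.Integer.Properties as ℤ
open import Data.Integer.Solver using (module +-*-Solver)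
open +-*-Solver using (solve; _:+_; _:-_; _:*_; :-_; _:=_)
open import Data.Nat.Base as ℕ using (ℕ; zero; suc)
import Data.Nat.GCD as ℕ
import Data.Nat.LCM as ℕ
open import Data.Product using (Σ; _×_; _,_; proj₁; proj₂; ∃-syntax)
open import Data.Sum using (inj₁; inj₂)
open import Data.Unit.Base using (tt)
open import Data.Vec.Base using (Vec; []; _∷_)
open import Data.Vec.Functional using (Vector; foldr)
open import Function.Bundles using (mk⇔)
open import Relation.Binary.PropositionalEquality
  using (_≡_; _≢_; _≗_; refl; sym; trans; cong; cong₂; subst; module ≡-Reasoning)
open import Relation.Nullary using (¬_; yes; no)
open import Relation.Nullary.Decidable using (does; dec-false; does-⇔)

open import Algebra.Properties.Group (AbelianGroup.group ℤ.+-0-abelianGroup)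
  using () renaming (∙-cancelʳ to +-cancelʳ)
open import Algebra.Properties.Semiring.Sum ℤ.+-*-semiring
  using (sum; sum-cong-≗; ∑-distrib-+; *-distribˡ-sum)

-- Divisibility and congruences in ℤ

gcd∣ˡ : ∀ a b → gcd a b ∣ a
gcd∣ˡ a b = ∣ᵤ⇒∣ (gcd[i,j]∣i a b)

gcd∣ʳ : ∀ a b → gcd a b ∣ b
gcd∣ʳ a b = ∣ᵤ⇒∣ (gcd[i,j]∣j a b)

∣gcd : ∀ {a b c} → c ∣ a → c ∣ b → c ∣ gcd a b
∣gcd {a} {b} {c} c∣a c∣b = ∣ᵤ⇒∣ (gcd-greatest {a} {b} {c} (∣⇒∣ᵤ c∣a) (∣⇒∣ᵤ c∣b))

∣lcmˡ : ∀ a b → a ∣ lcm a b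
∣lcmˡ a b = ∣ᵤ⇒∣ (i∣lcm[i,j] a b)

∣lcmʳ : ∀ a b → b ∣ lcm a b
∣lcmʳ a b = ∣ᵤ⇒∣ (j∣lcm[i,j] a b)

lcm∣ : ∀ {a b c} → a ∣ c → b ∣ c → lcm a b ∣ c
lcm∣ {a} {b} {c} a∣c b∣c = ∣ᵤ⇒∣ (lcm-least {a} {b} {c} (∣⇒∣ᵤ a∣c) (∣⇒∣ᵤ b∣c))

∣0 : ∀ k → k ∣ 0ℤ
∣0 k = divides 0ℤ refl

1∣ : ∀ a → 1ℤ ∣ a
1∣ a = divides a (sym (ℤ.*-identityʳ a))

gcd[1,a]∣ : ∀ a z → gcd 1ℤ a ∣ z
gcd[1,a]∣ a z = subst (_∣ z) (sym (gcd-zeroˡ a)) (1∣ z)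

gcd[a,1]∣ : ∀ a z → gcd a 1ℤ ∣ z
gcd[a,1]∣ a z = subst (_∣ z) (sym (gcd-zeroʳ a)) (1∣ z)

*-mono-∣ : ∀ {a b c d} → a ∣ b → c ∣ d → a * c ∣ b * d
*-mono-∣ {a} {b} {c} {d} a∣b c∣d = ∣-trans (*-monoˡ-∣ c a∣b) (*-monoʳ-∣ b c∣d)

∣-diff-refl : ∀ k a → k ∣ a - a
∣-diff-refl k a = subst (k ∣_) (sym (ℤ.+-inverseʳ a)) (∣0 k)

∣-diff-sym : ∀ {k} a b → k ∣ a - b → k ∣ b - a
∣-diff-sym {k} a b k∣a-b = subst (k ∣_) (negate-diff a b) (∣m⇒∣-m k∣a-b)
  where
  negate-diff : ∀ a b → - (a - b) ≡ b - a
  negate-diff = solve 2 (λ a b → :- (a :- b) := b :- a) refl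

∣-diff-trans : ∀ {k} a b c → k ∣ a - b → k ∣ b - c → k ∣ a - c
∣-diff-trans {k} a b c k∣a-b k∣b-c = subst (k ∣_) (telescope a b c) (∣m∣n⇒∣m+n k∣a-b k∣b-c)
  where
  telescope : ∀ a b c → (a - b) + (b - c) ≡ a - c
  telescope = solve 3 (λ a b c → (a :- b) :+ (b :- c) := a :- c) refl

∣-diff⇒∣ : ∀ {k} a b → k ∣ a → k ∣ a - b → k ∣ b
∣-diff⇒∣ {k} a b k∣a k∣a-b = subst (k ∣_) (cancel a b) (∣m∣n⇒∣m-n k∣a k∣a-b)
  where
  cancel : ∀ a b → a - (a - b) ≡ b
  cancel = solve 2 (λ a b → a :- (a :- b) := b) refl

gcd*lcm : ∀ a b → gcd a b * lcm a b ≡ + ∣ a * b ∣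
gcd*lcm a b = begin
  + ℕ.gcd α β * + ℕ.lcm α β   ≡⟨ ℤ.pos-* (ℕ.gcd α β) _ ⟨
  + (ℕ.gcd α β ℕ.* ℕ.lcm α β) ≡⟨ cong +_ (ℕ.gcd*lcm α β) ⟩
  + (α ℕ.* β)                 ≡⟨ cong +_ (ℤ.abs-* a b) ⟨
  + ∣ a * b ∣                 ∎
  where
  open ≡-Reasoning
  α β : ℕ
  α = ∣ a ∣
  β = ∣ b ∣

lcm≢0 : ∀ {a b} → a ≢ 0ℤ → b ≢ 0ℤ → lcm a b ≢ 0ℤ
lcm≢0 {a} {b} a≢0 b≢0 lcm≡0 with ℤ.i*j≡0⇒i≡0∨j≡0 a ab≡0
  where
  ab≡0 : a * b ≡ 0ℤ
  ab≡0 = ℤ.∣i∣≡0⇒i≡0 (ℤ.+-injective (begin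
    + ∣ a * b ∣           ≡⟨ gcd*lcm a b ⟨
    gcd a b * lcm a b     ≡⟨ cong (gcd a b *_) lcm≡0 ⟩
    gcd a b * 0ℤ          ≡⟨ ℤ.*-zeroʳ (gcd a b) ⟩
    0ℤ                    ∎))
    where open ≡-Reasoning
... | inj₁ a≡0 = a≢0 a≡0
... | inj₂ b≡0 = b≢0 b≡0

gcd≢0 : ∀ {a} b → a ≢ 0ℤ → gcd a b ≢ 0ℤ
gcd≢0 {a} b a≢0 gcd≡0 = a≢0 (gcd[i,j]≡0⇒i≡0 a b gcd≡0)

private
  ∣i∣≡ε*i : ∀ a → ∃[ ε ] + ∣ a ∣ ≡ ε * a
  ∣i∣≡ε*i a with ℤ.+∣i∣≡i⊎+∣i∣≡-i a
  ... | inj₁ e = 1ℤ , trans e (sym (ℤ.*-identityˡ a))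
  ... | inj₂ e = -1ℤ , trans e (sym (ℤ.-1*i≡-i a))

  -- Bézout's identity for natural numbers comes with two sign patterns; this turns one into ℤ.
  bézout-from-ℕ : ∀ {d} a b (x y : ℕ) → d ℕ.+ y ℕ.* ∣ b ∣ ≡ x ℕ.* ∣ a ∣ →
                  ∃[ s ] ∃[ t ] + d ≡ s * a + t * b
  bézout-from-ℕ {d} a b x y eq with ∣i∣≡ε*i a | ∣i∣≡ε*i b
  ... | εa , ea | εb , eb = + x * εa , - (+ y * εb) , (begin
    + d                                 ≡⟨ cancel (+ d) (+ y * + ∣ b ∣) ⟩
    (+ d + + y * + ∣ b ∣) - + y * + ∣ b ∣ ≡⟨ cong (_- + y * + ∣ b ∣) eq′ ⟩
    + x * + ∣ a ∣ - + y * + ∣ b ∣         ≡⟨ cong₂ (λ α β → + x * α - + y * β) ea eb ⟩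
    + x * (εa * a) - + y * (εb * b)     ≡⟨ regroup (+ x) (+ y) εa εb a b ⟩
    + x * εa * a + - (+ y * εb) * b     ∎)
    where
    open ≡-Reasoning
    eq′ : + d + + y * + ∣ b ∣ ≡ + x * + ∣ a ∣
    eq′ = begin
      + d + + y * + ∣ b ∣     ≡⟨ cong (λ z → + d + z) (ℤ.pos-* y _) ⟨
      + d + + (y ℕ.* ∣ b ∣)   ≡⟨ ℤ.pos-+ d _ ⟨
      + (d ℕ.+ y ℕ.* ∣ b ∣)   ≡⟨ cong +_ eq ⟩
      + (x ℕ.* ∣ a ∣)         ≡⟨ ℤ.pos-* x _ ⟩
      + x * + ∣ a ∣           ∎
    cancel : ∀ u v → u ≡ (u + v) - v
    cancel = solve 2 (λ u v → u := (u :+ v) :- v) refl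
    regroup : ∀ x y εa εb a b → x * (εa * a) - y * (εb * b) ≡ x * εa * a + - (y * εb) * b
    regroup = solve 6 (λ x y εa εb a b → x :* (εa :* a) :- y :* (εb :* b) :=
                                         x :* εa :* a :+ (:- (y :* εb)) :* b) refl

bézout : ∀ a b → ∃[ s ] ∃[ t ] gcd a b ≡ s * a + t * b
bézout a b with ℕ.Bézout.identity (ℕ.gcd-GCD ∣ a ∣ ∣ b ∣)
... | ℕ.Bézout.+- x y eq = bézout-from-ℕ a b x y eq
... | ℕ.Bézout.-+ x y eq with bézout-from-ℕ b a y x eq
...   | s , t , e = t , s , trans e (ℤ.+-comm (s * b) (t * a))

-- With u = (a,c), v = (b,c), h = (u,v) and D = ([a,b],c): D·h divides u·v = h·[u,v].
gcd-lcm∣lcm-gcd : ∀ a b c → gcd (gcd a c) (gcd b c) ≢ 0ℤ →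
                  gcd (lcm a b) c ∣ lcm (gcd a c) (gcd b c)
gcd-lcm∣lcm-gcd a b c h≢0 = *-cancelʳ-∣ h {{≢-nonZero h≢0}} Dh∣[u,v]h
  where
  u v h D : ℤ
  u = gcd a c
  v = gcd b c
  h = gcd u v
  D = gcd (lcm a b) c
  h∣a : h ∣ a
  h∣a = ∣-trans (gcd∣ˡ u v) (gcd∣ˡ a c)
  h∣b : h ∣ b
  h∣b = ∣-trans (gcd∣ʳ u v) (gcd∣ˡ b c)
  h∣c : h ∣ c
  h∣c = ∣-trans (gcd∣ˡ u v) (gcd∣ʳ a c)
  Dh∣ab : D * h ∣ a * b
  Dh∣ab = ∣-trans (*-mono-∣ (gcd∣ˡ (lcm a b) c) (∣gcd h∣a h∣b))
            (subst (_∣ a * b) (trans (sym (gcd*lcm a b)) (ℤ.*-comm (gcd a b) (lcm a b))) ∣m∣∣m)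
  Dh∣uv : D * h ∣ u * v
  Dh∣uv with bézout a c | bézout b c
  ... | s₁ , t₁ , u≡ | s₂ , t₂ , v≡ =
    subst (D * h ∣_) (sym uv≡)
      (∣m∣n⇒∣m+n (∣m⇒∣m*n (s₁ * s₂) Dh∣ab)
                 (*-mono-∣ (gcd∣ʳ (lcm a b) c)
                   (∣m∣n⇒∣m+n (∣m∣n⇒∣m+n (∣n⇒∣m*n (s₁ * t₂) h∣a) (∣n⇒∣m*n (t₁ * s₂) h∣b))
                              (∣n⇒∣m*n (t₁ * t₂) h∣c))))
    where
    expand : ∀ a b c s₁ t₁ s₂ t₂ → (s₁ * a + t₁ * c) * (s₂ * b + t₂ * c) ≡
             a * b * (s₁ * s₂) + c * (s₁ * t₂ * a + t₁ * s₂ * b + t₁ * t₂ * c)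
    expand = solve 7 (λ a b c s₁ t₁ s₂ t₂ → (s₁ :* a :+ t₁ :* c) :* (s₂ :* b :+ t₂ :* c) :=
                        a :* b :* (s₁ :* s₂) :+ c :* (s₁ :* t₂ :* a :+ t₁ :* s₂ :* b :+ t₁ :* t₂ :* c)) refl
    uv≡ : u * v ≡ a * b * (s₁ * s₂) + c * (s₁ * t₂ * a + t₁ * s₂ * b + t₁ * t₂ * c)
    uv≡ = trans (cong₂ _*_ u≡ v≡) (expand a b c s₁ t₁ s₂ t₂)
  Dh∣[u,v]h : D * h ∣ lcm u v * h
  Dh∣[u,v]h = subst (D * h ∣_) (trans (sym (gcd*lcm u v)) (ℤ.*-comm h (lcm u v)))
                (∣-trans Dh∣uv m∣∣m∣)

gcd-lcm∣ : ∀ a b c {y} → gcd a c ∣ y → gcd b c ∣ y → gcd (lcm a b) c ∣ y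
gcd-lcm∣ a b c {y} u∣y v∣y with gcd (gcd a c) (gcd b c) ℤ.≟ 0ℤ
... | no h≢0  = ∣-trans (gcd-lcm∣lcm-gcd a b c h≢0) (lcm∣ u∣y v∣y)
... | yes h≡0 = subst (gcd (lcm a b) c ∣_) (sym y≡0) (∣0 (gcd (lcm a b) c))
  where
  y≡0 : y ≡ 0ℤ
  y≡0 = 0∣⇒≡0 (subst (_∣ y) (gcd[i,j]≡0⇒i≡0 (gcd a c) (gcd b c) h≡0) u∣y)

crt₂ : ∀ a₀ q₀ a₁ q₁ → gcd q₀ q₁ ∣ a₁ - a₀ → ∃[ y ] (q₀ ∣ y - a₀) × (q₁ ∣ y - a₁)
crt₂ a₀ q₀ a₁ q₁ (divides k a₁-a₀≡kg) with bézout q₀ q₁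
... | s , t , g≡ = a₀ + k * s * q₀ , divides (k * s) (cancel a₀ (k * s * q₀)) , divides (- (k * t)) y-a₁≡
  where
  open ≡-Reasoning
  cancel : ∀ a x → a + x - a ≡ x
  cancel = solve 2 (λ a x → a :+ x :- a := x) refl
  y-a₁≡ : a₀ + k * s * q₀ - a₁ ≡ - (k * t) * q₁
  y-a₁≡ = begin
    a₀ + k * s * q₀ - a₁             ≡⟨ shift a₀ a₁ (k * s * q₀) ⟩
    k * s * q₀ - (a₁ - a₀)           ≡⟨ cong (λ z → k * s * q₀ - z) (trans a₁-a₀≡kg (ℤ.*-comm k _)) ⟩
    k * s * q₀ - gcd q₀ q₁ * k       ≡⟨ cong (λ g → k * s * q₀ - g * k) g≡ ⟩
    k * s * q₀ - (s * q₀ + t * q₁) * k ≡⟨ collect k s t q₀ q₁ ⟩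
    - (k * t) * q₁                   ∎
    where
    shift : ∀ a₀ a₁ x → a₀ + x - a₁ ≡ x - (a₁ - a₀)
    shift = solve 3 (λ a₀ a₁ x → a₀ :+ x :- a₁ := x :- (a₁ :- a₀)) refl
    collect : ∀ k s t q₀ q₁ → k * s * q₀ - (s * q₀ + t * q₁) * k ≡ - (k * t) * q₁
    collect = solve 5 (λ k s t q₀ q₁ → k :* s :* q₀ :- (s :* q₀ :+ t :* q₁) :* k := :- (k :* t) :* q₁) refl

merge-compatible : ∀ a₀ q₀ a₁ q₁ a q y → q₀ ∣ y - a₀ → q₁ ∣ y - a₁ →
                   gcd q₀ q ∣ a - a₀ → gcd q₁ q ∣ a - a₁ → gcd (lcm q₀ q₁) q ∣ a - y
merge-compatible a₀ q₀ a₁ q₁ a q y y≡a₀ y≡a₁ a≡a₀ a≡a₁ = gcd-lcm∣ q₀ q₁ q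
  (∣-diff-trans a a₀ y a≡a₀ (∣-diff-sym y a₀ (∣-trans (gcd∣ˡ q₀ q) y≡a₀)))
  (∣-diff-trans a a₁ y a≡a₁ (∣-diff-sym y a₁ (∣-trans (gcd∣ˡ q₁ q) y≡a₁)))

crt : ∀ {k} a₀ q₀ (a q : Vector ℤ k) →
      (∀ i → gcd q₀ (q i) ∣ a i - a₀) → (∀ i j → gcd (q i) (q j) ∣ a i - a j) →
      ∃[ x ] (q₀ ∣ x - a₀) × (∀ i → q i ∣ x - a i)
crt {zero}  a₀ q₀ a q _ _ = a₀ , ∣-diff-refl q₀ a₀ , λ ()
crt {suc k} a₀ q₀ a q compat₀ compat = merge (crt₂ a₀ q₀ (a zero) (q zero) (compat₀ zero))
  where
  Solution : ℤ → ℤ → Set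
  Solution a₀ q₀ = ∃[ x ] (q₀ ∣ x - a₀) × (∀ i → q i ∣ x - a i)
  merge : ∃[ y ] (q₀ ∣ y - a₀) × (q zero ∣ y - a zero) → Solution a₀ q₀
  merge (y , y≡a₀ , y≡a₁) = finish (crt y (lcm q₀ (q zero)) (λ i → a (suc i)) (λ i → q (suc i))
                                        compat-y (λ i j → compat (suc i) (suc j)))
    where
    compat-y : ∀ i → gcd (lcm q₀ (q zero)) (q (suc i)) ∣ a (suc i) - y
    compat-y i = merge-compatible a₀ q₀ (a zero) (q zero) (a (suc i)) (q (suc i)) y y≡a₀ y≡a₁
                   (compat₀ (suc i)) (∣-diff-sym (a zero) (a (suc i)) (compat zero (suc i)))
    finish : ∃[ x ] (lcm q₀ (q zero) ∣ x - y) × (∀ i → q (suc i) ∣ x - a (suc i)) → Solution a₀ q₀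
    finish (x , x≡y , x≡aᵢ) = x , ∣-diff-trans x y a₀ (∣-trans (∣lcmˡ q₀ (q zero)) x≡y) y≡a₀ , x≡a
      where
      x≡a : ∀ i → q i ∣ x - a i
      x≡a zero    = ∣-diff-trans x y (a zero) (∣-trans (∣lcmʳ q₀ (q zero)) x≡y) y≡a₁
      x≡a (suc i) = x≡aᵢ i

lcmᶠ : ∀ {k} → ℤ → Vector ℤ k → ℤ
lcmᶠ a q = foldr lcm a q

∣lcmᶠ-seed : ∀ {k} a (q : Vector ℤ k) → a ∣ lcmᶠ a q
∣lcmᶠ-seed {zero}  a q = ∣-refl
∣lcmᶠ-seed {suc k} a q = ∣-trans (∣lcmᶠ-seed a (λ i → q (suc i))) (∣lcmʳ (q zero) (lcmᶠ a (λ i → q (suc i))))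

∣lcmᶠ : ∀ {k} a (q : Vector ℤ k) i → q i ∣ lcmᶠ a q
∣lcmᶠ a q zero    = ∣lcmˡ (q zero) (lcmᶠ a (λ i → q (suc i)))
∣lcmᶠ a q (suc i) = ∣-trans (∣lcmᶠ a (λ i → q (suc i)) i) (∣lcmʳ (q zero) (lcmᶠ a (λ i → q (suc i))))

lcmᶠ∣ : ∀ {k} a (q : Vector ℤ k) {y} → a ∣ y → (∀ i → q i ∣ y) → lcmᶠ a q ∣ y
lcmᶠ∣ {zero}  a q a∣y q∣y = a∣y
lcmᶠ∣ {suc k} a q a∣y q∣y = lcm∣ {q zero} (q∣y zero) (lcmᶠ∣ a (λ i → q (suc i)) a∣y (λ i → q∣y (suc i)))

lcmᶠ≢0 : ∀ {k} a (q : Vector ℤ k) → a ≢ 0ℤ → (∀ i → q i ≢ 0ℤ) → lcmᶠ a q ≢ 0ℤ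
lcmᶠ≢0 {zero}  a q a≢0 q≢0 = a≢0
lcmᶠ≢0 {suc k} a q a≢0 q≢0 = lcm≢0 (q≢0 zero) (lcmᶠ≢0 a (λ i → q (suc i)) a≢0 (λ i → q≢0 (suc i)))

-- Vectors and splines

_-V_ : ∀ {n} → V n → V n → V n
(f -V g) x = f x - g x

_∷ʳ_ : ∀ {n} → V n → ℤ → V (suc n)
(g ∷ʳ x) i with view i
... | ‵fromℕ      = x
... | ‵inject₁ j  = g j

∷ʳ-inject₁ : ∀ {n} (g : V n) x w → (g ∷ʳ x) (inject₁ w) ≡ g w
∷ʳ-inject₁ g x w rewrite view-inject₁ w = refl

∷ʳ-fromℕ : ∀ {n} (g : V n) x → (g ∷ʳ x) (fromℕ n) ≡ x
∷ʳ-fromℕ {n} g x rewrite view-fromℕ n = refl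

elimTop : ∀ {n} (P : Fin (suc n) → Set) → (∀ w → P (inject₁ w)) → P (fromℕ n) → ∀ x → P x
elimTop P P-inject₁ P-top x with view x
... | ‵fromℕ     = P-top
... | ‵inject₁ w = P-inject₁ w

combination : ∀ {k n} → Vector ℤ k → Vector (V n) k → V n
combination c B x = sum (λ i → c i * B i x)

combination-congᶜ : ∀ {k n} {c c′ : Vector ℤ k} (B : Vector (V n) k) x →
                    c ≗ c′ → combination c B x ≡ combination c′ B x
combination-congᶜ B x c≗c′ = sum-cong-≗ (λ i → cong (_* B i x) (c≗c′ i))

combination-congᴮ : ∀ {k n m} (c : Vector ℤ k) (B : Vector (V n) k) x (B′ : Vector (V m) k) y →
                    (∀ i → B i x ≡ B′ i y) → combination c B x ≡ combination c B′ y
combination-congᴮ c B x B′ y B≗B′ = sum-cong-≗ (λ i → cong (c i *_) (B≗B′ i))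

combination-+ : ∀ {k n} (c c′ : Vector ℤ k) (B : Vector (V n) k) x →
                combination (λ i → c i + c′ i) B x ≡ combination c B x + combination c′ B x
combination-+ c c′ B x =
  trans (sum-cong-≗ (λ i → ℤ.*-distribʳ-+ (B i x) (c i) (c′ i)))
        (∑-distrib-+ (λ i → c i * B i x) (λ i → c′ i * B i x))

combination-* : ∀ {k n} a (c : Vector ℤ k) (B : Vector (V n) k) x →
                combination (λ i → a * c i) B x ≡ a * combination c B x
combination-* a c B x =
  trans (sum-cong-≗ (λ i → ℤ.*-assoc a (c i) (B i x))) (sym (*-distribˡ-sum a (λ i → c i * B i x)))

-- Spline with signed divisibility. Without η for this record, conversion checking never unfolds
-- spline proofs, which otherwise normalises whole gcd computations.
record IsSpline {n} (G : EGraph n) (f : V n) : Set where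
  no-eta-equality
  pattern
  constructor isSpline
  field
    vertex∣ : ∀ v → m G v ∣ f v
    edge∣   : ∀ u v → adj G u v ≡ true → r G u v ∣ f u - f v

module _ {n} {G : EGraph n} where

  Spline⇒IsSpline : ∀ {f} → Spline G f → IsSpline G f
  Spline⇒IsSpline (m∣ , r∣) = isSpline (λ v → ∣ᵤ⇒∣ (m∣ v)) (λ u v e → ∣ᵤ⇒∣ (r∣ u v e))

  IsSpline⇒Spline : ∀ {f} → IsSpline G f → Spline G f
  IsSpline⇒Spline (isSpline m∣ r∣) = (λ v → ∣⇒∣ᵤ (m∣ v)) , (λ u v e → ∣⇒∣ᵤ (r∣ u v e))

  spline-cong : ∀ {f g} → f ≈V g → IsSpline G f → IsSpline G g
  spline-cong {f} {g} f≈g (isSpline m∣ r∣) =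
    isSpline (λ v → subst (m G v ∣_) (f≈g v) (m∣ v))
    (λ u v e → subst (r G u v ∣_) (cong₂ _-_ (f≈g u) (f≈g v)) (r∣ u v e))

  spline-+ : ∀ {f g} → IsSpline G f → IsSpline G g → IsSpline G (f +V g)
  spline-+ {f} {g} (isSpline m∣f r∣f) (isSpline m∣g r∣g) =
    isSpline (λ v → ∣m∣n⇒∣m+n (m∣f v) (m∣g v))
    (λ u v e → subst (r G u v ∣_) (interchange (f u) (f v) (g u) (g v)) (∣m∣n⇒∣m+n (r∣f u v e) (r∣g u v e)))
    where
    interchange : ∀ a b c d → (a - b) + (c - d) ≡ (a + c) - (b + d)
    interchange = solve 4 (λ a b c d → (a :- b) :+ (c :- d) := (a :+ c) :- (b :+ d)) refl

  spline-- : ∀ {f g} → IsSpline G f → IsSpline G g → IsSpline G (f -V g)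
  spline-- {f} {g} (isSpline m∣f r∣f) (isSpline m∣g r∣g) =
    isSpline (λ v → ∣m∣n⇒∣m-n (m∣f v) (m∣g v))
    (λ u v e → subst (r G u v ∣_) (interchange (f u) (f v) (g u) (g v)) (∣m∣n⇒∣m-n (r∣f u v e) (r∣g u v e)))
    where
    interchange : ∀ a b c d → (a - b) - (c - d) ≡ (a - c) - (b - d)
    interchange = solve 4 (λ a b c d → (a :- b) :- (c :- d) := (a :- c) :- (b :- d)) refl

  spline-· : ∀ c {f} → IsSpline G f → IsSpline G (c ·V f)
  spline-· c {f} (isSpline m∣ r∣) =
    isSpline (λ v → ∣n⇒∣m*n c (m∣ v))
    (λ u v e → subst (r G u v ∣_) (distrib c (f u) (f v)) (∣n⇒∣m*n c (r∣ u v e)))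
    where
    distrib : ∀ c a b → c * (a - b) ≡ c * a - c * b
    distrib = solve 3 (λ c a b → c :* (a :- b) := c :* a :- c :* b) refl

  spline-combination : ∀ {k} (c : Vector ℤ k) (B : Vector (V n) k) →
                       (∀ i → IsSpline G (B i)) → IsSpline G (combination c B)
  spline-combination {zero}  c B _ = isSpline (λ v → ∣0 (m G v)) (λ u v _ → ∣0 (r G u v))
  spline-combination {suc k} c B B-spline =
    spline-+ (spline-· (c zero) (B-spline zero))
             (spline-combination (λ i → c (suc i)) (λ i → B (suc i)) (λ i → B-spline (suc i)))

-- `reduce` labels a vertex w by joinLabels true m_w (w ∼ v) (m_v , r_vw) and an edge ww′ by
-- joinLabels (ww′ ∈ E) r_ww′ (ww′ is new) (r_vw , r_vw′), definitionally: the lcm of the flagged labels.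
joinLabels : Bool → ℤ → Bool → ℤ → ℤ
joinLabels a x b y = if a then (if b then lcm x y else x) else y

joinLabels∣ : ∀ a x b y {z} → (a ≡ true → x ∣ z) → (b ≡ true → y ∣ z) → a ∨ b ≡ true →
              joinLabels a x b y ∣ z
joinLabels∣ true  x true  y x∣z y∣z _ = lcm∣ {x} {y} (x∣z refl) (y∣z refl)
joinLabels∣ true  x false y x∣z y∣z _ = x∣z refl
joinLabels∣ false x true  y x∣z y∣z _ = y∣z refl

∣joinLabelsˡ : ∀ a x b y → a ≡ true → x ∣ joinLabels a x b y
∣joinLabelsˡ true x true  y _ = ∣lcmˡ x y
∣joinLabelsˡ true x false y _ = ∣-refl

∣joinLabelsʳ : ∀ a x b y → b ≡ true → y ∣ joinLabels a x b y
∣joinLabelsʳ true  x true y _ = ∣lcmʳ x y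
∣joinLabelsʳ false x true y _ = ∣-refl

joinLabels≢0 : ∀ a x b y → (a ≡ true → x ≢ 0ℤ) → (b ≡ true → y ≢ 0ℤ) → a ∨ b ≡ true →
               joinLabels a x b y ≢ 0ℤ
joinLabels≢0 true  x true  y x≢0 y≢0 _ = lcm≢0 (x≢0 refl) (y≢0 refl)
joinLabels≢0 true  x false y x≢0 y≢0 _ = x≢0 refl
joinLabels≢0 false x true  y x≢0 y≢0 _ = y≢0 refl

joinLabels-cong : ∀ {a a′ x x′ b b′ y y′} → a ≡ a′ → x ≡ x′ → b ≡ b′ → y ≡ y′ →
                  joinLabels a x b y ≡ joinLabels a′ x′ b′ y′
joinLabels-cong refl refl refl refl = refl

if-elim : ∀ {A : Set} (P : A → Set) b {x y} → (b ≡ true → P x) → (b ≡ false → P y) → P (if b then x else y)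
if-elim P true  P-then P-else = P-then refl
if-elim P false P-then P-else = P-else refl

if-true : ∀ {A : Set} {b} {x y : A} → b ≡ true → (if b then x else y) ≡ x
if-true refl = refl

∨-introˡ : ∀ {a} b → a ≡ true → a ∨ b ≡ true
∨-introˡ b refl = refl

∨-introʳ : ∀ a {b} → b ≡ true → a ∨ b ≡ true
∨-introʳ true  _ = refl
∨-introʳ false b≡true = b≡true

-- The reduction step

record Admissible {n} (G : EGraph n) : Set where
  field
    adj-sym : ∀ u v → adj G u v ≡ adj G v u
    r-sym   : ∀ u v → r G u v ≡ r G v u
    m≢0     : ∀ v → m G v ≢ 0ℤ
    r≢0     : ∀ u v → adj G u v ≡ true → r G u v ≢ 0ℤ

record SplineBasis {n} (G : EGraph n) : Set where
  field
    basis        : Vector (V n) n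
    basis-spline : ∀ i → IsSpline G (basis i)
    spans        : ∀ f → IsSpline G f → ∃[ c ] f ≈V combination c basis
    independent  : ∀ c c′ → combination c basis ≈V combination c′ basis → c ≗ c′

  coords : ∀ f → IsSpline G f → Vector ℤ n
  coords f p = proj₁ (spans f p)

  expand : ∀ f p → f ≈V combination (coords f p) basis
  expand f p = proj₂ (spans f p)

  coords-unique : ∀ {f g} p q → f ≈V g → coords f p ≗ coords g q
  coords-unique {f} {g} p q f≈g =
    independent (coords f p) (coords g q) (λ x → trans (sym (expand f p x)) (trans (f≈g x) (expand g q x)))

  coords-+ : ∀ {f g} p q pq → coords (f +V g) pq ≗ (λ i → coords f p i + coords g q i)
  coords-+ {f} {g} p q pq = independent _ _ λ x → begin
    combination (coords (f +V g) pq) basis x                     ≡⟨ expand (f +V g) pq x ⟨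
    f x + g x                                                    ≡⟨ cong₂ _+_ (expand f p x) (expand g q x) ⟩
    combination (coords f p) basis x + combination (coords g q) basis x
                                                                 ≡⟨ combination-+ (coords f p) (coords g q) basis x ⟨
    combination (λ i → coords f p i + coords g q i) basis x      ∎
    where open ≡-Reasoning

  coords-· : ∀ a {f} p ap → coords (a ·V f) ap ≗ (λ i → a * coords f p i)
  coords-· a {f} p ap = independent _ _ λ x → begin
    combination (coords (a ·V f) ap) basis x          ≡⟨ expand (a ·V f) ap x ⟨
    a * f x                                           ≡⟨ cong (a *_) (expand f p x) ⟩
    a * combination (coords f p) basis x              ≡⟨ combination-* a (coords f p) basis x ⟨
    combination (λ i → a * coords f p i) basis x      ∎
    where open ≡-Reasoning

empty-basis : (G : EGraph 0) → SplineBasis G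
empty-basis G = record
  { basis = λ (); basis-spline = λ (); spans = λ _ _ → (λ ()) , (λ ()); independent = λ _ _ _ () }

record LinearSection {n} (G : EGraph (suc n)) : Set where
  field
    σ        : ∀ g → IsSpline (reduce G) g → V (suc n)
    σ-spline : ∀ g p → IsSpline G (σ g p)
    ψ∘σ      : ∀ g p → ψ (σ g p) ≈V g
    σ-cong   : ∀ {g h} p q → g ≈V h → σ g p ≈V σ h q
    σ-+      : ∀ {g h} p q pq → σ (g +V h) pq ≈V (σ g p +V σ h q)
    σ-·      : ∀ a {g} p ap → σ (a ·V g) ap ≈V (a ·V σ g p)

module Reduction {n} (G : EGraph (suc n)) where

  top : Fin (suc n)
  top = fromℕ n

  G′ : EGraph n
  G′ = reduce G

  isNeighbour : Fin n → Bool
  isNeighbour w = adj G top (inject₁ w)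

  newEdge : Fin n → Fin n → Bool
  newEdge w w′ = isNeighbour w ∧ isNeighbour w′ ∧ not (does (w ≟ w′))

  newEdge-sym : ∀ w w′ → newEdge w w′ ≡ newEdge w′ w
  newEdge-sym w w′ = swap (isNeighbour w) (isNeighbour w′) (cong not (does-⇔ (mk⇔ sym sym) (w ≟ w′) (w′ ≟ w)))
    where
    swap : ∀ a b {c c′} → c ≡ c′ → a ∧ b ∧ c ≡ b ∧ a ∧ c′
    swap true  true  refl = refl
    swap true  false refl = refl
    swap false true  refl = refl
    swap false false refl = refl

  newEdge⇒neighbourˡ : ∀ w w′ → newEdge w w′ ≡ true → isNeighbour w ≡ true
  newEdge⇒neighbourˡ w w′ = ∧-conicalˡ (isNeighbour w) _

  newEdge⇒neighbourʳ : ∀ w w′ → newEdge w w′ ≡ true → isNeighbour w′ ≡ true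
  newEdge⇒neighbourʳ w w′ e = ∧-conicalˡ (isNeighbour w′) _ (∧-conicalʳ (isNeighbour w) _ e)

  neighbours⇒newEdge : ∀ {w w′} → isNeighbour w ≡ true → isNeighbour w′ ≡ true → w ≢ w′ → newEdge w w′ ≡ true
  neighbours⇒newEdge {w} {w′} nb nb′ w≢w′ rewrite nb | nb′ | dec-false (w ≟ w′) w≢w′ = refl

  ψ-spline : ∀ {f} → IsSpline G f → IsSpline G′ (ψ f)
  ψ-spline {f} (isSpline m∣ r∣) = isSpline vertex edge
    where
    vertex : ∀ w → m G′ w ∣ ψ f w
    vertex w = joinLabels∣ true (m G (inject₁ w)) (isNeighbour w) (gcd (m G top) (r G top (inject₁ w)))
      (λ _ → m∣ (inject₁ w))
      (λ nb → ∣-diff⇒∣ (f top) (f (inject₁ w))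
                (∣-trans (gcd∣ˡ (m G top) (r G top (inject₁ w))) (m∣ top))
                (∣-trans (gcd∣ʳ (m G top) (r G top (inject₁ w))) (r∣ top (inject₁ w) nb)))
      refl
    edge : ∀ w w′ → adj G′ w w′ ≡ true → r G′ w w′ ∣ ψ f w - ψ f w′
    edge w w′ = joinLabels∣ (adj G (inject₁ w) (inject₁ w′)) (r G (inject₁ w) (inject₁ w′))
                  (newEdge w w′) (gcd (r G top (inject₁ w)) (r G top (inject₁ w′)))
      (r∣ (inject₁ w) (inject₁ w′))
      (λ ne → ∣-diff-trans (f (inject₁ w)) (f top) (f (inject₁ w′))
                (∣-diff-sym (f top) (f (inject₁ w))
                  (∣-trans (gcd∣ˡ (r G top (inject₁ w)) (r G top (inject₁ w′)))
                           (r∣ top (inject₁ w) (newEdge⇒neighbourˡ w w′ ne))))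
                (∣-trans (gcd∣ʳ (r G top (inject₁ w)) (r G top (inject₁ w′)))
                         (r∣ top (inject₁ w′) (newEdge⇒neighbourʳ w w′ ne))))

  reduce-admissible : Admissible G → Admissible G′
  reduce-admissible adm = record
    { adj-sym = λ w w′ → cong₂ _∨_ (adj-sym (inject₁ w) (inject₁ w′)) (newEdge-sym w w′)
    ; r-sym   = λ w w′ → joinLabels-cong (adj-sym (inject₁ w) (inject₁ w′)) (r-sym (inject₁ w) (inject₁ w′))
                           (newEdge-sym w w′) (gcd-comm (r G top (inject₁ w)) (r G top (inject₁ w′)))
    ; m≢0     = λ w → joinLabels≢0 true (m G (inject₁ w)) (isNeighbour w) (gcd (m G top) (r G top (inject₁ w)))
                        (λ _ → m≢0 (inject₁ w)) (λ _ → gcd≢0 (r G top (inject₁ w)) (m≢0 top)) refl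
    ; r≢0     = λ w w′ → joinLabels≢0 (adj G (inject₁ w) (inject₁ w′)) (r G (inject₁ w) (inject₁ w′))
                           (newEdge w w′) (gcd (r G top (inject₁ w)) (r G top (inject₁ w′)))
                           (r≢0 (inject₁ w) (inject₁ w′))
                           (λ ne → gcd≢0 (r G top (inject₁ w′)) (r≢0 top (inject₁ w) (newEdge⇒neighbourˡ w w′ ne)))
    }
    where open Admissible adm

  -- The modulus by which w constrains the value at top; 1 (no constraint) for non-neighbours.
  neighbourModulus : Fin n → ℤ
  neighbourModulus w = if isNeighbour w then r G top (inject₁ w) else 1ℤ

  top-compatible : ∀ {g} → IsSpline G′ g → ∀ w → gcd (m G top) (neighbourModulus w) ∣ g w - 0ℤ
  top-compatible {g} (isSpline m∣ r∣) w = if-elim (λ q → gcd (m G top) q ∣ g w - 0ℤ) (isNeighbour w)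
    (λ nb → subst (gcd (m G top) (r G top (inject₁ w)) ∣_) (sym (ℤ.+-identityʳ (g w)))
              (∣-trans (∣joinLabelsʳ true (m G (inject₁ w)) (isNeighbour w)
                         (gcd (m G top) (r G top (inject₁ w))) nb)
                       (m∣ w)))
    (λ _ → gcd[a,1]∣ (m G top) (g w - 0ℤ))

  neighbours-compatible : ∀ {g} → IsSpline G′ g →
                          ∀ i j → gcd (neighbourModulus i) (neighbourModulus j) ∣ g i - g j
  neighbours-compatible {g} (isSpline m∣ r∣) i j with i ≟ j
  ... | yes refl = ∣-diff-refl (gcd (neighbourModulus i) (neighbourModulus i)) (g i)
  ... | no i≢j = if-elim (λ q → gcd q (neighbourModulus j) ∣ g i - g j) (isNeighbour i)
    (λ nbᵢ → if-elim (λ q → gcd (r G top (inject₁ i)) q ∣ g i - g j) (isNeighbour j)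
      (λ nbⱼ → let ne = neighbours⇒newEdge nbᵢ nbⱼ i≢j in
        ∣-trans (∣joinLabelsʳ (adj G (inject₁ i) (inject₁ j)) (r G (inject₁ i) (inject₁ j))
                  (newEdge i j) (gcd (r G top (inject₁ i)) (r G top (inject₁ j))) ne)
                (r∣ i j (∨-introʳ (adj G (inject₁ i) (inject₁ j)) ne)))
      (λ _ → gcd[a,1]∣ (r G top (inject₁ i)) (g i - g j)))
    (λ _ → gcd[1,a]∣ (neighbourModulus j) (g i - g j))

  module _ (adm : Admissible G) where
    open Admissible adm

    spline-∷ʳ : ∀ g x → (∀ w → m G (inject₁ w) ∣ g w) → m G top ∣ x →
                (∀ w w′ → adj G (inject₁ w) (inject₁ w′) ≡ true →
                          r G (inject₁ w) (inject₁ w′) ∣ g w - g w′) →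
                (∀ w → isNeighbour w ≡ true → r G top (inject₁ w) ∣ x - g w) →
                IsSpline G (g ∷ʳ x)
    spline-∷ʳ g x m∣g m∣x r∣g r∣x = isSpline vertex edge
      where
      vertex : ∀ u → m G u ∣ (g ∷ʳ x) u
      vertex u with view u
      ... | ‵fromℕ     = m∣x
      ... | ‵inject₁ w = m∣g w
      edge : ∀ u v → adj G u v ≡ true → r G u v ∣ (g ∷ʳ x) u - (g ∷ʳ x) v
      edge u v e with view u | view v
      ... | ‵fromℕ     | ‵fromℕ      = ∣-diff-refl (r G top top) x
      ... | ‵fromℕ     | ‵inject₁ w′ = r∣x w′ e
      ... | ‵inject₁ w | ‵fromℕ      = subst (_∣ g w - x) (r-sym top (inject₁ w))
                                         (∣-diff-sym x (g w) (r∣x w (trans (adj-sym top (inject₁ w)) e)))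
      ... | ‵inject₁ w | ‵inject₁ w′ = r∣g w w′ e

    lift : ∀ g → IsSpline G′ g → ∃[ x ] IsSpline G (g ∷ʳ x)
    lift g p@(isSpline m∣ r∣)
      with crt 0ℤ (m G top) g neighbourModulus (top-compatible p) (neighbours-compatible p)
    ... | x , m∣x , x≡g = x , spline-∷ʳ g x
      (λ w → ∣-trans (∣joinLabelsˡ true (m G (inject₁ w)) (isNeighbour w)
                       (gcd (m G top) (r G top (inject₁ w))) refl) (m∣ w))
      (subst (m G top ∣_) (ℤ.+-identityʳ x) m∣x)
      (λ w w′ e → ∣-trans (∣joinLabelsˡ (adj G (inject₁ w) (inject₁ w′)) (r G (inject₁ w) (inject₁ w′))
                            (newEdge w w′) (gcd (r G top (inject₁ w)) (r G top (inject₁ w′))) e)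
                          (r∣ w w′ (∨-introˡ (newEdge w w′) e)))
      (λ w nb → subst (_∣ x - g w) (if-true nb) (x≡g w))

    kernelModulus : ℤ
    kernelModulus = lcmᶠ (m G top) neighbourModulus

    kernelModulus≢0 : kernelModulus ≢ 0ℤ
    kernelModulus≢0 = lcmᶠ≢0 (m G top) neighbourModulus (m≢0 top)
      (λ w → if-elim (_≢ 0ℤ) (isNeighbour w) (r≢0 top (inject₁ w)) (λ _ ()))

    kernelModulus∣ : ∀ {f} → IsSpline G f → (∀ w → ψ f w ≡ 0ℤ) → kernelModulus ∣ f top
    kernelModulus∣ {f} (isSpline m∣ r∣) ψf≡0 = lcmᶠ∣ (m G top) neighbourModulus (m∣ top)
      (λ w → if-elim (_∣ f top) (isNeighbour w)
               (λ nb → subst (r G top (inject₁ w) ∣_) (f-top-0 w) (r∣ top (inject₁ w) nb))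
               (λ _ → 1∣ (f top)))
      where
      f-top-0 : ∀ w → f top - f (inject₁ w) ≡ f top
      f-top-0 w = trans (cong (λ z → f top - z) (ψf≡0 w)) (ℤ.+-identityʳ (f top))

    kernelGenerator : V (suc n)
    kernelGenerator = (λ _ → 0ℤ) ∷ʳ kernelModulus

    kernelGenerator-inject₁ : ∀ w → kernelGenerator (inject₁ w) ≡ 0ℤ
    kernelGenerator-inject₁ = ∷ʳ-inject₁ (λ _ → 0ℤ) kernelModulus

    kernelGenerator-top : kernelGenerator top ≡ kernelModulus
    kernelGenerator-top = ∷ʳ-fromℕ {n} (λ _ → 0ℤ) kernelModulus

    kernelGenerator-spline : IsSpline G kernelGenerator
    kernelGenerator-spline = spline-∷ʳ (λ _ → 0ℤ) kernelModulus
      (λ w → ∣0 (m G (inject₁ w)))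
      (∣lcmᶠ-seed (m G top) neighbourModulus)
      (λ w w′ _ → ∣0 (r G (inject₁ w) (inject₁ w′)))
      (λ w nb → subst (r G top (inject₁ w) ∣_) (sym (ℤ.+-identityʳ kernelModulus))
                  (subst (_∣ kernelModulus) (if-true nb) (∣lcmᶠ (m G top) neighbourModulus w)))

    kernelGenerator∈Ker : Ker G kernelGenerator
    kernelGenerator∈Ker = IsSpline⇒Spline kernelGenerator-spline , kernelGenerator-inject₁

    kernel-rank1 : KerRank1 G
    kernel-rank1 = ((kernelGenerator ∷ []) , (kernelGenerator∈Ker ∷ []) , generates) , minimal
      where
      generates : ∀ f → Ker G f → Σ (Vec ℤ 1) λ cs → f ≈V lincomb cs (kernelGenerator ∷ [])
      generates f (f-spline , ψf≡0) with kernelModulus∣ (Spline⇒IsSpline {f = f} f-spline) ψf≡0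
      ... | divides q f-top≡qd = (q ∷ []) , f≈qK
        where
        f≈qK : ∀ x → f x ≡ q * kernelGenerator x + 0ℤ
        f≈qK x with view x
        ... | ‵fromℕ     = trans f-top≡qd (sym (ℤ.+-identityʳ (q * kernelModulus)))
        ... | ‵inject₁ w = trans (ψf≡0 w) (cong (_+ 0ℤ) (sym (ℤ.*-zeroʳ q)))
      minimal : ∀ j (gs : Vec (V (suc n)) j) → GeneratedBy (Ker G) gs → 1 ℕ.≤ j
      minimal zero    []  (_ , gen) with gen kernelGenerator kernelGenerator∈Ker
      ... | [] , K≈0 = ⊥-elim (kernelModulus≢0 (trans (sym kernelGenerator-top) (K≈0 top)))
      minimal (suc j) _   _ = ℕ.s≤s ℕ.z≤n

    module _ (B′ : SplineBasis G′) where
      open SplineBasis B′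

      lifted : Vector (V (suc n)) n
      lifted i = basis i ∷ʳ proj₁ (lift (basis i) (basis-spline i))

      combination-lifted : ∀ c w → combination c lifted (inject₁ w) ≡ combination c basis w
      combination-lifted c w =
        combination-congᴮ c lifted (inject₁ w) basis w (λ i → ∷ʳ-inject₁ (basis i) _ w)

      section : LinearSection G
      section = record
        { σ        = σ
        ; σ-spline = λ g p → spline-combination (coords g p) lifted
                               (λ i → proj₂ (lift (basis i) (basis-spline i)))
        ; ψ∘σ      = λ g p w → trans (combination-lifted (coords g p) w) (sym (expand g p w))
        ; σ-cong   = λ p q g≈h x → combination-congᶜ lifted x (coords-unique p q g≈h)
        ; σ-+      = λ p q pq x → trans (combination-congᶜ lifted x (coords-+ p q pq))
                                        (combination-+ (coords _ p) (coords _ q) lifted x)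
        ; σ-·      = λ a p ap x → trans (combination-congᶜ lifted x (coords-· a p ap))
                                        (combination-* a (coords _ p) lifted x)
        }
        where
        σ : ∀ g → IsSpline G′ g → V (suc n)
        σ g p = combination (coords g p) lifted

      open LinearSection section using (σ; σ-spline; ψ∘σ)

      extendedBasis : Vector (V (suc n)) (suc n)
      extendedBasis zero    = kernelGenerator
      extendedBasis (suc i) = lifted i

      kernel+section : ∀ f (p : IsSpline G f) q → f top - σ (ψ f) (ψ-spline p) top ≡ q * kernelModulus →
                       ∀ x → f x ≡ q * kernelGenerator x + σ (ψ f) (ψ-spline p) x
      kernel+section f p q f-σψf≡qd = elimTop (λ x → f x ≡ q * kernelGenerator x + s x) at-inject₁ at-top
        where
        open ≡-Reasoning
        s : V (suc n)
        s = σ (ψ f) (ψ-spline p)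
        at-inject₁ : ∀ w → f (inject₁ w) ≡ q * kernelGenerator (inject₁ w) + s (inject₁ w)
        at-inject₁ w = begin
          f (inject₁ w)                               ≡⟨ ψ∘σ (ψ f) (ψ-spline p) w ⟨
          s (inject₁ w)                               ≡⟨ ℤ.+-identityˡ (s (inject₁ w)) ⟨
          0ℤ + s (inject₁ w)                          ≡⟨ cong (_+ s (inject₁ w)) (ℤ.*-zeroʳ q) ⟨
          q * 0ℤ + s (inject₁ w)                      ≡⟨ cong (λ k → q * k + s (inject₁ w)) (kernelGenerator-inject₁ w) ⟨
          q * kernelGenerator (inject₁ w) + s (inject₁ w) ∎
        at-top : f top ≡ q * kernelGenerator top + s top
        at-top = begin
          f top                            ≡⟨ reassemble (f top) (s top) ⟨
          (f top - s top) + s top          ≡⟨ cong (_+ s top) f-σψf≡qd ⟩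
          q * kernelModulus + s top        ≡⟨ cong (λ k → q * k + s top) kernelGenerator-top ⟨
          q * kernelGenerator top + s top  ∎
          where
          reassemble : ∀ a b → (a - b) + b ≡ a
          reassemble = solve 2 (λ a b → (a :- b) :+ b := a) refl

      extendedBasis-spans : ∀ f → IsSpline G f → ∃[ c ] f ≈V combination c extendedBasis
      extendedBasis-spans f p with kernelModulus∣ (spline-- p (σ-spline (ψ f) (ψ-spline p))) ψ[f-σψf]≡0
        where
        ψ[f-σψf]≡0 : ∀ w → f (inject₁ w) - σ (ψ f) (ψ-spline p) (inject₁ w) ≡ 0ℤ
        ψ[f-σψf]≡0 w = trans (cong (λ z → f (inject₁ w) - z) (ψ∘σ (ψ f) (ψ-spline p) w))
                             (ℤ.+-inverseʳ (f (inject₁ w)))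
      ... | divides q f-σψf≡qd = c , kernel+section f p q f-σψf≡qd
        where
        c : Vector ℤ (suc n)
        c zero    = q
        c (suc i) = coords (ψ f) (ψ-spline p) i

      extendedBasis-restrict : ∀ c w → combination c extendedBasis (inject₁ w) ≡
                                       combination (λ i → c (suc i)) basis w
      extendedBasis-restrict c w = begin
        c zero * kernelGenerator (inject₁ w) + X ≡⟨ cong (λ k → c zero * k + X) (kernelGenerator-inject₁ w) ⟩
        c zero * 0ℤ + X                         ≡⟨ cong (_+ X) (ℤ.*-zeroʳ (c zero)) ⟩
        0ℤ + X                                  ≡⟨ ℤ.+-identityˡ X ⟩
        X                                       ≡⟨ combination-lifted (λ i → c (suc i)) w ⟩
        combination (λ i → c (suc i)) basis w   ∎
        where
        open ≡-Reasoning
        X : ℤ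
        X = combination (λ i → c (suc i)) lifted (inject₁ w)

      extendedBasis-independent : ∀ c c′ → combination c extendedBasis ≈V combination c′ extendedBasis →
                                  c ≗ c′
      extendedBasis-independent c c′ eq = coefficient
        where
        open ≡-Reasoning
        tail≗ : ∀ i → c (suc i) ≡ c′ (suc i)
        tail≗ = independent (λ i → c (suc i)) (λ i → c′ (suc i)) λ w → begin
          combination (λ i → c (suc i)) basis w   ≡⟨ extendedBasis-restrict c w ⟨
          combination c extendedBasis (inject₁ w)  ≡⟨ eq (inject₁ w) ⟩
          combination c′ extendedBasis (inject₁ w) ≡⟨ extendedBasis-restrict c′ w ⟩
          combination (λ i → c′ (suc i)) basis w  ∎
        Y Y′ : ℤ
        Y  = combination (λ i → c (suc i)) lifted top
        Y′ = combination (λ i → c′ (suc i)) lifted top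
        head≡ : c zero * kernelModulus ≡ c′ zero * kernelModulus
        head≡ = +-cancelʳ Y (c zero * kernelModulus) (c′ zero * kernelModulus) (begin
          c zero * kernelModulus + Y          ≡⟨ cong (λ k → c zero * k + Y) kernelGenerator-top ⟨
          combination c extendedBasis top     ≡⟨ eq top ⟩
          combination c′ extendedBasis top    ≡⟨ cong (λ k → c′ zero * k + Y′) kernelGenerator-top ⟩
          c′ zero * kernelModulus + Y′        ≡⟨ cong (λ z → c′ zero * kernelModulus + z)
                                                   (combination-congᶜ lifted top tail≗) ⟨
          c′ zero * kernelModulus + Y         ∎)
        coefficient : c ≗ c′
        coefficient zero    =
          ℤ.*-cancelʳ-≡ (c zero) (c′ zero) kernelModulus {{≢-nonZero kernelModulus≢0}} head≡
        coefficient (suc i) = tail≗ i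

      basis-step : SplineBasis G
      basis-step = record
        { basis        = extendedBasis
        ; basis-spline = λ { zero    → kernelGenerator-spline
                           ; (suc i) → proj₂ (lift (basis i) (basis-spline i)) }
        ; spans        = extendedBasis-spans
        ; independent  = extendedBasis-independent
        }

-- The decomposition

≈T-trans : ∀ {n} {s t u : Tup n} → s ≈T t → t ≈T u → s ≈T u
≈T-trans {zero}  _ _ = tt
≈T-trans {suc n} (f≈g , s≈t) (g≈h , t≈u) = (λ x → trans (f≈g x) (g≈h x)) , ≈T-trans s≈t t≈u

empty-iso : (G : EGraph 0) → SplineSumIso G
empty-iso G = record
  { Φ = λ _ _ → tt ; Φ-into = λ _ _ → tt ; Φ-cong = λ _ _ _ _ _ → tt ; Φ-add = λ _ _ _ _ _ → tt
  ; Φ-scale = λ _ _ _ _ → tt ; Φ-inj = λ _ _ _ _ _ () ; Φ-surj = λ _ _ → (λ ()) , isSpline′ , tt }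
  where
  isSpline′ : Spline G (λ ())
  isSpline′ = (λ ()) , (λ ())

module Splitting {n} {G : EGraph (suc n)} (S : LinearSection G) where
  open LinearSection S
  open Reduction G using (ψ-spline)

  ψˢ : ∀ f → Spline G f → IsSpline (reduce G) (ψ f)
  ψˢ f p = ψ-spline (Spline⇒IsSpline {f = f} p)

  kernelPart : ∀ f → Spline G f → V (suc n)
  kernelPart f p = f -V σ (ψ f) (ψˢ f p)

  kernelPart∈Ker : ∀ f p → Ker G (kernelPart f p)
  kernelPart∈Ker f p =
    IsSpline⇒Spline (spline-- (Spline⇒IsSpline {f = f} p) (σ-spline (ψ f) (ψˢ f p))) ,
    λ w → trans (cong (λ z → f (inject₁ w) - z) (ψ∘σ (ψ f) (ψˢ f p) w)) (ℤ.+-inverseʳ (f (inject₁ w)))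

  kernelPart-cong : ∀ f g p q → f ≈V g → kernelPart f p ≈V kernelPart g q
  kernelPart-cong f g p q f≈g x = cong₂ _-_ (f≈g x) (σ-cong (ψˢ f p) (ψˢ g q) (λ w → f≈g (inject₁ w)) x)

  kernelPart-+ : ∀ f g p q pq → kernelPart (f +V g) pq ≈V (kernelPart f p +V kernelPart g q)
  kernelPart-+ f g p q pq x =
    trans (cong (λ s → f x + g x - s) (σ-+ (ψˢ f p) (ψˢ g q) (ψˢ (f +V g) pq) x))
          (interchange (f x) (g x) (σ (ψ f) (ψˢ f p) x) (σ (ψ g) (ψˢ g q) x))
    where
    interchange : ∀ a b c d → a + b - (c + d) ≡ (a - c) + (b - d)
    interchange = solve 4 (λ a b c d → a :+ b :- (c :+ d) := (a :- c) :+ (b :- d)) refl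

  kernelPart-· : ∀ c f p cp → kernelPart (c ·V f) cp ≈V (c ·V kernelPart f p)
  kernelPart-· c f p cp x =
    trans (cong (λ s → c * f x - s) (σ-· c (ψˢ f p) (ψˢ (c ·V f) cp) x))
          (factor c (f x) (σ (ψ f) (ψˢ f p) x))
    where
    factor : ∀ c a b → c * a - c * b ≡ c * (a - b)
    factor = solve 3 (λ c a b → c :* a :- c :* b := c :* (a :- b)) refl

  reassemble : ∀ f g p q → kernelPart f p ≈V kernelPart g q → ψ f ≈V ψ g → f ≈V g
  reassemble f g p q kf≈kg ψf≈ψg x = begin
    f x                                 ≡⟨ add-back (f x) (σ (ψ f) (ψˢ f p) x) ⟨
    kernelPart f p x + σ (ψ f) (ψˢ f p) x ≡⟨ cong₂ _+_ (kf≈kg x) (σ-cong (ψˢ f p) (ψˢ g q) ψf≈ψg x) ⟩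
    kernelPart g q x + σ (ψ g) (ψˢ g q) x ≡⟨ add-back (g x) (σ (ψ g) (ψˢ g q) x) ⟩
    g x                                 ∎
    where
    open ≡-Reasoning
    add-back : ∀ a b → (a - b) + b ≡ a
    add-back = solve 2 (λ a b → (a :- b) :+ b := a) refl

  kernelPart-k+σg : ∀ k g (ψk≡0 : ∀ w → ψ k w ≡ 0ℤ) (gˢ : IsSpline (reduce G) g) p →
                    kernelPart (k +V σ g gˢ) p ≈V k × ψ (k +V σ g gˢ) ≈V g
  kernelPart-k+σg k g ψk≡0 gˢ p = k≈ , ψf≈g
    where
    ψf≈g : ψ (k +V σ g gˢ) ≈V g
    ψf≈g w = trans (cong₂ _+_ (ψk≡0 w) (ψ∘σ g gˢ w)) (ℤ.+-identityˡ (g w))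
    k≈ : kernelPart (k +V σ g gˢ) p ≈V k
    k≈ x = trans (cong (λ s → k x + σ g gˢ x - s) (σ-cong (ψˢ (k +V σ g gˢ) p) gˢ ψf≈g x))
                 (cancel (k x) (σ g gˢ x))
      where
      cancel : ∀ a b → a + b - b ≡ a
      cancel = solve 2 (λ a b → a :+ b :- b := a) refl

iso-step : ∀ {n} {G : EGraph (suc n)} → LinearSection G → SplineSumIso (reduce G) → SplineSumIso G
iso-step {n} {G} S S′ = record
  { Φ       = Φ
  ; Φ-into  = λ f p → kernelPart∈Ker f p , Φ′-into (ψ f) (ψᵘ f p)
  ; Φ-cong  = λ f g p q f≈g →
      kernelPart-cong f g p q f≈g , Φ′-cong (ψ f) (ψ g) (ψᵘ f p) (ψᵘ g q) (λ w → f≈g (inject₁ w))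
  ; Φ-add   = λ f g p q pq →
      kernelPart-+ f g p q pq , Φ′-add (ψ f) (ψ g) (ψᵘ f p) (ψᵘ g q) (ψᵘ (f +V g) pq)
  ; Φ-scale = λ c f p cp → kernelPart-· c f p cp , Φ′-scale c (ψ f) (ψᵘ f p) (ψᵘ (c ·V f) cp)
  ; Φ-inj   = λ f g p q (kf≈kg , Φ′f≈Φ′g) →
      reassemble f g p q kf≈kg (Φ′-inj (ψ f) (ψ g) (ψᵘ f p) (ψᵘ g q) Φ′f≈Φ′g)
  ; Φ-surj  = surj
  }
  where
  open LinearSection S using (σ; σ-spline)
  open Splitting S
  open SplineSumIso S′ using () renaming
    (Φ to Φ′; Φ-into to Φ′-into; Φ-cong to Φ′-cong; Φ-add to Φ′-add; Φ-scale to Φ′-scale;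
     Φ-inj to Φ′-inj; Φ-surj to Φ′-surj)

  ψᵘ : ∀ f → Spline G f → Spline (reduce G) (ψ f)
  ψᵘ f p = IsSpline⇒Spline (ψˢ f p)

  Φ : (f : V (suc n)) → Spline G f → Tup (suc n)
  Φ f p = kernelPart f p , Φ′ (ψ f) (ψᵘ f p)

  surj : ∀ t → InSum G t → Σ (V (suc n)) λ f → Σ (Spline G f) λ p → Φ f p ≈T t
  surj (k , t′) ((kᵘ , ψk≡0) , t′∈) = fromPreimage (Φ′-surj t′ t′∈)
    where
    fromPreimage : Σ (V n) (λ g → Σ (Spline (reduce G) g) λ q → Φ′ g q ≈T t′) →
                   Σ (V (suc n)) λ f → Σ (Spline G f) λ p → Φ f p ≈T (k , t′)
    fromPreimage (g , gᵘ , Φ′g≈t′) = f , p , k≈ , ≈T-trans (Φ′-cong (ψ f) g (ψᵘ f p) gᵘ ψf≈g) Φ′g≈t′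
      where
      gˢ : IsSpline (reduce G) g
      gˢ = Spline⇒IsSpline {f = g} gᵘ
      f : V (suc n)
      f = k +V σ g gˢ
      p : Spline G f
      p = IsSpline⇒Spline (spline-+ (Spline⇒IsSpline {f = k} kᵘ) (σ-spline g gˢ))
      k≈ : kernelPart f p ≈V k
      k≈ = proj₁ (kernelPart-k+σg k g ψk≡0 gˢ p)
      ψf≈g : ψ f ≈V g
      ψf≈g = proj₂ (kernelPart-k+σg k g ψk≡0 gˢ p)

decompose : ∀ {n} (G : EGraph n) → Admissible G → SplineBasis G × SplineSumIso G
decompose {zero}  G _   = empty-basis G , empty-iso G
decompose {suc n} G adm with decompose (reduce G) (Reduction.reduce-admissible G adm)
... | B′ , S′ = Reduction.basis-step G adm B′ , iso-step (Reduction.section G adm B′) S′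

ψ-wellDefined : ∀ {n} (G : EGraph n) → AllStages PsiWellDefined G
ψ-wellDefined {zero}  G = tt
ψ-wellDefined {suc n} G =
  (λ f p → IsSpline⇒Spline (Reduction.ψ-spline G (Spline⇒IsSpline {f = f} p))) , ψ-wellDefined (reduce G)

kernels-rank1 : ∀ {n} (G : EGraph n) → Admissible G → AllStages KerRank1 G
kernels-rank1 {zero}  G _   = tt
kernels-rank1 {suc n} G adm =
  Reduction.kernel-rank1 G adm , kernels-rank1 (reduce G) (Reduction.reduce-admissible G adm)

corollary4p11 : ∀ {n : ℕ} (G : EGraph n) → WellFormed G
    → (∀ v → ¬ (m G v ≡ 0ℤ))
    → (∀ u v → adj G u v ≡ true → ¬ (r G u v ≡ 0ℤ))
    → AllStages PsiWellDefined G × SplineSumIso G × AllStages KerRank1 G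
corollary4p11 G wf m≢0 r≢0 = ψ-wellDefined G , proj₂ (decompose G adm) , kernels-rank1 G adm
  where
  adm : Admissible G
  adm = record { adj-sym = WellFormed.adj-sym wf ; r-sym = WellFormed.r-sym wf ; m≢0 = m≢0 ; r≢0 = r≢0 }
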